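{- Let $G=(V,E)$ be a graph without isolated vertices, let $\alpha\in\mathbb{N}$, and let $\mathcal{C}$ be a sigma clique cover of $G$ with $\mathrm{wgt}(\mathcal{C}) \le |V|+\alpha$ and $|C|>1$ for all $C\in\mathcal{C}$. Then either $G$ is a cluster graph, or there is a vertex $u\in V$ such that $u$ can be split in $G$ to obtain a graph $G'=(V',E')$ satisfying: (1) $G'$ has a sigma clique cover $\mathcal{C}'$ such that (2) $\mathrm{wgt}(\mathcal{C}') \le |V'|+\alpha-1$ and (3) $|C'|>1$ for all $C'\in\mathcal{C}'$; and (4) $G'$ has no isolated vertices.
   Context: Graphs are finite, simple, undirected. A \emph{cluster graph} is a graph in which every connected component is a clique. Splitting $u\in V$ produces the graph with vertex set $(V\setminus\{u\})\cup\{v,w\}$ ($v,w$ new), keeping all edges not incident to $u$ and distributing the edges incident to $u$ among $v$ and $w$ so that $N_{G'}(v)\cup N_{G'}(w)=N_G(u)$. A \emph{sigma clique cover} of a graph $H$ is a set $\mathcal{C}$ of subsets of $V(H)$ such that $H[C]$ is a clique for every $C\in\mathcal{C}$ and every edge of $H$ has both endpoints in some $C\in\mathcal{C}$; its weight is $\mathrm{wgt}(\mathcal{C})=\sum_{C\in\mathcal{C}}|C|$. -}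

module Defs where

open import Data.Nat using (ℕ; suc; _+_; _≤_; _<_)
open import Data.Bool using (Bool; true; false; _∨_)
open import Data.Fin using (Fin; inject₁; fromℕ)
open import Data.Fin.Subset using (Subset; _∈_; ∣_∣)
open import Data.List using (List; map)
open import Data.Nat.ListAction using (sum)
open import Data.List.Relation.Unary.All using (All)
open import Data.List.Relation.Unary.Any using (Any)
open import Data.List.Relation.Unary.Unique.Propositional using (Unique)
open import Data.Product using (Σ; ∃; _×_; _,_)
open import Relation.Binary.PropositionalEquality using (_≡_)
open import Relation.Nullary using (¬_)

record Graph (n : ℕ) : Set where
  field
    adj   : Fin n → Fin n → Bool
    sym   : ∀ x y → adj x y ≡ adj y x
    irref : ∀ x → adj x x ≡ false
open Graph public

Adj : ∀ {n} → Graph n → Fin n → Fin n → Set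
Adj G x y = adj G x y ≡ true

data Reach {n} (G : Graph n) : Fin n → Fin n → Set where
  here : ∀ {x} → Reach G x x
  step : ∀ {x y z} → Adj G x y → Reach G y z → Reach G x z

IsClusterGraph : ∀ {n} → Graph n → Set
IsClusterGraph G = ∀ x y → Reach G x y → ¬ (x ≡ y) → Adj G x y

NoIsolated : ∀ {n} → Graph n → Set
NoIsolated {n} G = ∀ x → ∃ λ (y : Fin n) → Adj G x y

IsClique : ∀ {n} → Graph n → Subset n → Set
IsClique G C = ∀ x y → x ∈ C → y ∈ C → ¬ (x ≡ y) → Adj G x y

-- A sigma clique cover, represented as a duplicate-free list of vertex subsets
IsSigmaCliqueCover : ∀ {n} → Graph n → List (Subset n) → Set
IsSigmaCliqueCover G 𝒞 =
  Unique 𝒞 × All (IsClique G) 𝒞 ×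
  (∀ x y → Adj G x y → Any (λ C → x ∈ C × y ∈ C) 𝒞)

wgt : ∀ {n} → List (Subset n) → ℕ
wgt 𝒞 = sum (map ∣_∣ 𝒞)

AllLarge : ∀ {n} → List (Subset n) → Set
AllLarge 𝒞 = All (λ C → 1 < ∣ C ∣) 𝒞

-- G' (on Fin (suc n)) is obtained from G by splitting u.  Vertex x of G
-- corresponds to inject₁ x in G' for x ≢ u; the two new vertices are
-- v = inject₁ u and w = fromℕ n.
IsSplit : ∀ {n} → Graph n → Fin n → Graph (suc n) → Set
IsSplit {n} G u G' =
  (∀ x y → ¬ (x ≡ u) → ¬ (y ≡ u) → adj G' (inject₁ x) (inject₁ y) ≡ adj G x y) ×
  (∀ x → ¬ (x ≡ u) →
     adj G x u ≡ (adj G' (inject₁ x) (inject₁ u) ∨ adj G' (inject₁ x) (fromℕ n))) ×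
  adj G' (inject₁ u) (fromℕ n) ≡ false

-- A sigma clique cover determines its graph: x and y are adjacent iff x ≢ y and some
-- member of the cover contains both.  If no vertex lies in two members, adjacency never
-- leaves a member, so G is a cluster graph.  Otherwise some u lies in distinct members
-- C₁ and C₂; split u into v, which takes over u's place in C₁, and w, which takes it in
-- every other member, and let G' be the graph of the new cover.  Each member keeps its
-- size, so the weight is unchanged while the vertex count grows by one; v and w are
-- non-adjacent, and neither is isolated because C₁ and C₂ have other vertices.
module Submission where

open import Defs hiding (sym)
open import Data.Nat using (ℕ; suc; _+_; _≤_; _<_)
import Data.Nat.Properties as ℕ
open import Data.Fin using (Fin; zero; suc; inject₁; fromℕ; _≟_)
open import Data.Fin.Relation.Unary.Top using (View; view; ‵fromℕ; ‵inject₁)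
open import Data.Fin.Properties using (any?; inject₁-injective; fromℕ≢inject₁)
open import Data.Fin.Subset using (Subset; outside; inside; _∈_; _∉_; _⊆_; ⁅_⁆; ∣_∣)
open import Data.Fin.Subset.Properties using (_∈?_; x∈⁅x⁆; p⊆q⇒∣p∣≤∣q∣; ∣⁅x⁆∣≡1; ⊆-antisym)
open import Data.Bool using (Bool; true; false; _∨_)
open import Data.Bool.Properties using (T-≡) renaming (_≟_ to _≟ᵇ_)
open import Data.Vec using (Vec; []; _∷_; lookup; _[_]≔_; _∷ʳ_)
open import Data.Vec.Properties
  using ([]=⇒lookup; lookup⇒[]=; lookup∘update; lookup∘update′)
  renaming (≡-dec to ≡-decᵛ)
open import Data.List using (List; map)
open import Data.Nat.ListAction using (sum)
open import Data.List.Properties using (map-∘; map-cong)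
open import Data.List.Relation.Unary.All as All using (All)
import Data.List.Relation.Unary.All.Properties as All
open import Data.List.Relation.Unary.Any as Any using (Any)
import Data.List.Relation.Unary.Any.Properties as Any
open import Data.List.Relation.Unary.Unique.Propositional using (Unique)
import Data.List.Relation.Unary.Unique.Propositional.Properties as Unique
open import Data.List.Membership.Propositional using (find; lose) renaming (_∈_ to _∈ₗ_)
open import Data.Product using (∃; Σ; _×_; _,_; proj₁; proj₂; swap; map₂)
open import Data.Product.Function.NonDependent.Propositional using (_×-⇔_)
open import Data.Sum using (_⊎_; inj₁; inj₂)
open import Data.Sum.Function.Propositional using (_⊎-⇔_)
open import Function using (_∘_)
open import Function.Bundles using (_⇔_; mk⇔; Equivalence)
import Function.Properties.Equivalence as ⇔
open import Function.Properties.Inverse using (↔⇒⇔)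
open import Function.Related.TypeIsomorphisms using (×-distribˡ-⊎)
open import Relation.Nullary using (T?; ¬_; Dec; yes; no; does; contradiction; ¬?; _×-dec_; _⊎-dec_)
open import Relation.Nullary.Decidable using (does-⇔; dec-true; dec-false)
open import Relation.Binary.PropositionalEquality

open Equivalence using (to; from)

private
  variable
    m n : ℕ

∈⇔lookup : {x : Fin n} {p : Subset n} → x ∈ p ⇔ lookup p x ≡ inside
∈⇔lookup {x = x} {p} = mk⇔ []=⇒lookup (lookup⇒[]= x p)

lookup≡⇒∈⇔ : {x : Fin m} {y : Fin n} {p : Subset m} {q : Subset n} →
             lookup p x ≡ lookup q y → x ∈ p ⇔ y ∈ q
lookup≡⇒∈⇔ eq = mk⇔ (λ x∈p → from ∈⇔lookup (trans (sym eq) (to ∈⇔lookup x∈p)))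
                    (λ y∈q → from ∈⇔lookup (trans eq (to ∈⇔lookup y∈q)))

lookup≡outside⇒∉ : {x : Fin n} {p : Subset n} → lookup p x ≡ outside → x ∉ p
lookup≡outside⇒∉ eq x∈p with () ← trans (sym eq) (to ∈⇔lookup x∈p)

lookup-∷ʳ-inject₁ : {A : Set} (xs : Vec A n) (x : A) (i : Fin n) →
                    lookup (xs ∷ʳ x) (inject₁ i) ≡ lookup xs i
lookup-∷ʳ-inject₁ (y ∷ xs) x zero    = refl
lookup-∷ʳ-inject₁ (y ∷ xs) x (suc i) = lookup-∷ʳ-inject₁ xs x i

lookup-∷ʳ-fromℕ : {A : Set} (xs : Vec A n) (x : A) → lookup (xs ∷ʳ x) (fromℕ n) ≡ x
lookup-∷ʳ-fromℕ []   x = refl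
lookup-∷ʳ-fromℕ (y ∷ xs) x = lookup-∷ʳ-fromℕ xs x

∣p∷ʳx∣≡∣x∷p∣ : (p : Subset n) (x : Bool) → ∣ p ∷ʳ x ∣ ≡ ∣ x ∷ p ∣
∣p∷ʳx∣≡∣x∷p∣ []        x       = refl
∣p∷ʳx∣≡∣x∷p∣ (outside ∷ p) x       = ∣p∷ʳx∣≡∣x∷p∣ p x
∣p∷ʳx∣≡∣x∷p∣ (inside  ∷ p) outside = cong suc (∣p∷ʳx∣≡∣x∷p∣ p outside)
∣p∷ʳx∣≡∣x∷p∣ (inside  ∷ p) inside  = cong suc (∣p∷ʳx∣≡∣x∷p∣ p inside)

∣x∷y∷p∣≡∣y∷x∷p∣ : (x y : Bool) (p : Subset n) → ∣ x ∷ y ∷ p ∣ ≡ ∣ y ∷ x ∷ p ∣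
∣x∷y∷p∣≡∣y∷x∷p∣ outside y       p = refl
∣x∷y∷p∣≡∣y∷x∷p∣ inside  outside p = refl
∣x∷y∷p∣≡∣y∷x∷p∣ inside  inside  p = refl

∣lookup∷p[x]≔outside∣ : (p : Subset n) (x : Fin n) → ∣ lookup p x ∷ (p [ x ]≔ outside) ∣ ≡ ∣ p ∣
∣lookup∷p[x]≔outside∣ (b ∷ p)       zero    = refl
∣lookup∷p[x]≔outside∣ (outside ∷ p) (suc x) = ∣lookup∷p[x]≔outside∣ p x
∣lookup∷p[x]≔outside∣ (inside  ∷ p) (suc x) =
  trans (∣x∷y∷p∣≡∣y∷x∷p∣ (lookup p x) inside (p [ x ]≔ outside))
        (cong suc (∣lookup∷p[x]≔outside∣ p x))

inject₁-≢⇔ : {x y : Fin n} → (¬ inject₁ x ≡ inject₁ y) ⇔ (¬ x ≡ y)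
inject₁-≢⇔ = mk⇔ (λ x≢y → x≢y ∘ cong inject₁) (λ x≢y → x≢y ∘ inject₁-injective)

_≟ₛ_ : (p q : Subset n) → Dec (p ≡ q)
_≟ₛ_ = ≡-decᵛ _≟ᵇ_

Any-map⇔ : {A B : Set} {P : B → Set} {Q : A → Set} {f : A → B} {xs : List A} →
           (∀ {x} → P (f x) ⇔ Q x) → Any P (map f xs) ⇔ Any Q xs
Any-map⇔ P⇔Q = mk⇔ (Any.map (to P⇔Q) ∘ Any.map⁻) (Any.map⁺ ∘ Any.map (from P⇔Q))

wgt-map : {f : Subset m → Subset n} → (∀ p → ∣ f p ∣ ≡ ∣ p ∣) →
          (𝒞 : List (Subset m)) → wgt (map f 𝒞) ≡ wgt 𝒞
wgt-map {f = f} ∣f∣≗∣∣ 𝒞 = begin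
  sum (map ∣_∣ (map f 𝒞)) ≡⟨ cong sum (map-∘ 𝒞) ⟨
  sum (map (∣_∣ ∘ f) 𝒞)   ≡⟨ cong sum (map-cong ∣f∣≗∣∣ 𝒞) ⟩
  sum (map ∣_∣ 𝒞)         ∎
  where open ≡-Reasoning

AllLarge-map : {f : Subset m → Subset n} → (∀ p → ∣ f p ∣ ≡ ∣ p ∣) → {𝒞 : List (Subset m)} →
               AllLarge 𝒞 → AllLarge (map f 𝒞)
AllLarge-map ∣f∣≗∣∣ = All.map⁺ ∘ All.map (λ {p} → subst (1 <_) (sym (∣f∣≗∣∣ p)))

other-element : (p : Subset n) (u : Fin n) → 1 < ∣ p ∣ → ∃ λ y → ¬ y ≡ u × y ∈ p
other-element p u 1<∣p∣ with any? (λ y → ¬? (y ≟ u) ×-dec y ∈? p)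
... | yes found = found
... | no ∄ = contradiction (subst (∣ p ∣ ≤_) (∣⁅x⁆∣≡1 u) (p⊆q⇒∣p∣≤∣q∣ p⊆⁅u⁆)) (ℕ.<⇒≱ 1<∣p∣)
  where
  p⊆⁅u⁆ : p ⊆ ⁅ u ⁆
  p⊆⁅u⁆ {y} y∈p with y ≟ u
  ... | yes refl = x∈⁅x⁆ u
  ... | no y≢u   = contradiction (y , y≢u , y∈p) ∄

-- The copy v = inject₁ u keeps u's membership when the flag is true; otherwise it moves to
-- the copy w = fromℕ n.
module _ {n} (u : Fin n) where

  splitAt : Bool → Subset n → Subset (suc n)
  splitAt true  p = p ∷ʳ outside
  splitAt false p = (p [ u ]≔ outside) ∷ʳ lookup p u

  ∣splitAt∣ : ∀ b (p : Subset n) → ∣ splitAt b p ∣ ≡ ∣ p ∣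
  ∣splitAt∣ true  p = ∣p∷ʳx∣≡∣x∷p∣ p outside
  ∣splitAt∣ false p =
    trans (∣p∷ʳx∣≡∣x∷p∣ (p [ u ]≔ outside) (lookup p u)) (∣lookup∷p[x]≔outside∣ p u)

  lookup-splitAt-inject₁ : ∀ b (p : Subset n) {x} → ¬ x ≡ u →
                           lookup (splitAt b p) (inject₁ x) ≡ lookup p x
  lookup-splitAt-inject₁ true  p {x} x≢u = lookup-∷ʳ-inject₁ p outside x
  lookup-splitAt-inject₁ false p {x} x≢u =
    trans (lookup-∷ʳ-inject₁ (p [ u ]≔ outside) (lookup p u) x) (lookup∘update′ x≢u p outside)

  ∈-splitAt-inject₁ : ∀ b (p : Subset n) {x} → ¬ x ≡ u → inject₁ x ∈ splitAt b p ⇔ x ∈ p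
  ∈-splitAt-inject₁ b p x≢u = lookup≡⇒∈⇔ (lookup-splitAt-inject₁ b p x≢u)

  ∈-splitAt-v : ∀ b (p : Subset n) → inject₁ u ∈ splitAt b p ⇔ (b ≡ true × u ∈ p)
  ∈-splitAt-v true  p = ⇔.trans (lookup≡⇒∈⇔ (lookup-∷ʳ-inject₁ p outside u)) (mk⇔ (refl ,_) proj₂)
  ∈-splitAt-v false p = mk⇔ (λ v∈ → contradiction v∈ (lookup≡outside⇒∉ v∉)) (λ ())
    where
    v∉ : lookup (splitAt false p) (inject₁ u) ≡ outside
    v∉ = trans (lookup-∷ʳ-inject₁ (p [ u ]≔ outside) (lookup p u) u) (lookup∘update u p outside)

  ∈-splitAt-w : ∀ b (p : Subset n) → fromℕ n ∈ splitAt b p ⇔ (b ≡ false × u ∈ p)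
  ∈-splitAt-w true  p =
    mk⇔ (λ w∈ → contradiction w∈ (lookup≡outside⇒∉ (lookup-∷ʳ-fromℕ p outside))) (λ ())
  ∈-splitAt-w false p =
    ⇔.trans (lookup≡⇒∈⇔ (lookup-∷ʳ-fromℕ (p [ u ]≔ outside) (lookup p u))) (mk⇔ (refl ,_) proj₂)

  ∈-splitAt-v⊎w : ∀ b (p : Subset n) → (inject₁ u ∈ splitAt b p ⊎ fromℕ n ∈ splitAt b p) ⇔ u ∈ p
  ∈-splitAt-v⊎w b p = mk⇔ copy⁻ (copy b)
    where
    copy⁻ : inject₁ u ∈ splitAt b p ⊎ fromℕ n ∈ splitAt b p → u ∈ p
    copy⁻ (inj₁ v∈) = proj₂ (to (∈-splitAt-v b p) v∈)
    copy⁻ (inj₂ w∈) = proj₂ (to (∈-splitAt-w b p) w∈)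
    copy : ∀ b → u ∈ p → inject₁ u ∈ splitAt b p ⊎ fromℕ n ∈ splitAt b p
    copy true  u∈p = inj₁ (from (∈-splitAt-v true p) (refl , u∈p))
    copy false u∈p = inj₂ (from (∈-splitAt-w false p) (refl , u∈p))

  splitAt-⊆ : ∀ b b′ {p q : Subset n} → splitAt b p ≡ splitAt b′ q → p ⊆ q
  splitAt-⊆ b b′ {p} {q} eq {x} x∈p with x ≟ u
  ... | yes refl = to (∈-splitAt-v⊎w b′ q)
                      (subst (λ s → inject₁ u ∈ s ⊎ fromℕ n ∈ s) eq (from (∈-splitAt-v⊎w b p) x∈p))
  ... | no x≢u   = to (∈-splitAt-inject₁ b′ q x≢u)
                      (subst (inject₁ x ∈_) eq (from (∈-splitAt-inject₁ b p x≢u) x∈p))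

  splitAt-injective : ∀ b b′ {p q : Subset n} → splitAt b p ≡ splitAt b′ q → p ≡ q
  splitAt-injective b b′ eq = ⊆-antisym (splitAt-⊆ b b′ eq) (splitAt-⊆ b′ b (sym eq))

does≡true⇒ : {A : Set} (a? : Dec A) → does a? ≡ true → A
does≡true⇒ (yes a) _ = a

SharedBy : List (Subset n) → Fin n → Fin n → Set
SharedBy 𝒟 x y = Any (λ C → x ∈ C × y ∈ C) 𝒟

Joined : List (Subset n) → Fin n → Fin n → Set
Joined 𝒟 x y = ¬ x ≡ y × SharedBy 𝒟 x y

joined? : (𝒟 : List (Subset n)) (x y : Fin n) → Dec (Joined 𝒟 x y)
joined? 𝒟 x y = ¬? (x ≟ y) ×-dec Any.any? (λ C → x ∈? C ×-dec y ∈? C) 𝒟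

Joined-sym : {𝒟 : List (Subset n)} {x y : Fin n} → Joined 𝒟 x y → Joined 𝒟 y x
Joined-sym (x≢y , shared) = x≢y ∘ sym , Any.map swap shared

Joined⇔SharedBy : {𝒟 : List (Subset n)} {x y : Fin n} → ¬ x ≡ y → Joined 𝒟 x y ⇔ SharedBy 𝒟 x y
Joined⇔SharedBy x≢y = mk⇔ proj₂ (x≢y ,_)

coverGraph : List (Subset n) → Graph n
coverGraph 𝒟 = record
  { adj   = λ x y → does (joined? 𝒟 x y)
  ; sym   = λ x y → does-⇔ (mk⇔ Joined-sym Joined-sym) (joined? 𝒟 x y) (joined? 𝒟 y x)
  ; irref = λ x → dec-false (joined? 𝒟 x x) (λ (x≢x , _) → x≢x refl)
  }

Adj-coverGraph : {𝒟 : List (Subset n)} {x y : Fin n} → Adj (coverGraph 𝒟) x y ⇔ Joined 𝒟 x y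
Adj-coverGraph {𝒟 = 𝒟} {x} {y} = mk⇔ (does≡true⇒ (joined? 𝒟 x y)) (dec-true (joined? 𝒟 x y))

coverGraph-isSigmaCliqueCover : {𝒟 : List (Subset n)} →
                                Unique 𝒟 → IsSigmaCliqueCover (coverGraph 𝒟) 𝒟
coverGraph-isSigmaCliqueCover unique =
  unique ,
  All.tabulate (λ C∈ x y x∈C y∈C x≢y → from Adj-coverGraph (x≢y , lose C∈ (x∈C , y∈C))) ,
  λ x y xy → proj₂ (to Adj-coverGraph xy)

OverlapAt : List (Subset n) → Fin n → Set
OverlapAt 𝒞 u = Any (λ C₁ → Any (λ C₂ → ¬ C₁ ≡ C₂ × u ∈ C₁ × u ∈ C₂) 𝒞) 𝒞

overlapAt? : (𝒞 : List (Subset n)) (u : Fin n) → Dec (OverlapAt 𝒞 u)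
overlapAt? 𝒞 u = Any.any? (λ C₁ → Any.any? (λ C₂ → ¬? (C₁ ≟ₛ C₂) ×-dec u ∈? C₁ ×-dec u ∈? C₂) 𝒞) 𝒞

Nonoverlapping : List (Subset n) → Set
Nonoverlapping 𝒞 = ∀ {x C D} → C ∈ₗ 𝒞 → D ∈ₗ 𝒞 → x ∈ C → x ∈ D → C ≡ D

¬OverlapAt⇒Nonoverlapping : {𝒞 : List (Subset n)} → ¬ ∃ (OverlapAt 𝒞) → Nonoverlapping 𝒞
¬OverlapAt⇒Nonoverlapping ∄overlap {x} {C} {D} C∈𝒞 D∈𝒞 x∈C x∈D with C ≟ₛ D
... | yes C≡D = C≡D
... | no C≢D  = contradiction (x , lose C∈𝒞 (lose D∈𝒞 (C≢D , x∈C , x∈D))) ∄overlap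

module _ (G : Graph n) {𝒞 : List (Subset n)} (cover : IsSigmaCliqueCover G 𝒞) where

  Adj⇔Joined : {x y : Fin n} → Adj G x y ⇔ Joined 𝒞 x y
  Adj⇔Joined {x} {y} = mk⇔ joined adjacent
    where
    joined : Adj G x y → Joined 𝒞 x y
    joined xy = (λ { refl → contradiction (trans (sym xy) (irref G x)) λ () }) ,
                proj₂ (proj₂ cover) x y xy
    adjacent : Joined 𝒞 x y → Adj G x y
    adjacent (x≢y , shared) with find shared
    ... | C , C∈𝒞 , x∈C , y∈C = All.lookup (proj₁ (proj₂ cover)) C∈𝒞 x y x∈C y∈C x≢y

  adj≡adj-coverGraph : ∀ x y → adj G x y ≡ adj (coverGraph 𝒞) x y
  adj≡adj-coverGraph x y = does-⇔ (⇔.trans T-≡ Adj⇔Joined) (T? (adj G x y)) (joined? 𝒞 x y)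

  module _ (nonoverlapping : Nonoverlapping 𝒞) where

    Reach⇒SharedBy : {x z : Fin n} → Reach G x z → x ≡ z ⊎ SharedBy 𝒞 x z
    Reach⇒SharedBy here = inj₁ refl
    Reach⇒SharedBy (step xy reach) with find (proj₂ (to Adj⇔Joined xy)) | Reach⇒SharedBy reach
    ... | C , C∈𝒞 , x∈C , y∈C | inj₁ refl = inj₂ (lose C∈𝒞 (x∈C , y∈C))
    ... | C , C∈𝒞 , x∈C , y∈C | inj₂ yz with find yz
    ...   | D , D∈𝒞 , y∈D , z∈D with refl ← nonoverlapping C∈𝒞 D∈𝒞 y∈C y∈D =
      inj₂ (lose C∈𝒞 (x∈C , z∈D))

    nonoverlapping⇒isClusterGraph : IsClusterGraph G
    nonoverlapping⇒isClusterGraph x z reach x≢z with Reach⇒SharedBy reach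
    ... | inj₁ x≡z   = contradiction x≡z x≢z
    ... | inj₂ shared = from Adj⇔Joined (x≢z , shared)

module SplitCover {n} (𝒞 : List (Subset n)) (u : Fin n) (C₁ : Subset n) where

  toV : Subset n → Bool
  toV C = does (C ≟ₛ C₁)

  split : Subset n → Subset (suc n)
  split C = splitAt u (toV C) C

  𝒞′ : List (Subset (suc n))
  𝒞′ = map split 𝒞

  v w : Fin (suc n)
  v = inject₁ u
  w = fromℕ n

  Unique-split : Unique 𝒞 → Unique 𝒞′
  Unique-split = Unique.map⁺ λ {C} {D} → splitAt-injective u (toV C) (toV D)

  wgt-split : wgt 𝒞′ ≡ wgt 𝒞
  wgt-split = wgt-map (λ C → ∣splitAt∣ u (toV C) C) 𝒞

  AllLarge-split : AllLarge 𝒞 → AllLarge 𝒞′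
  AllLarge-split = AllLarge-map (λ C → ∣splitAt∣ u (toV C) C)

  SharedBy-split-inject₁ : {x y : Fin n} → ¬ x ≡ u → ¬ y ≡ u →
                           SharedBy 𝒞′ (inject₁ x) (inject₁ y) ⇔ SharedBy 𝒞 x y
  SharedBy-split-inject₁ x≢u y≢u = Any-map⇔ λ {C} →
    ∈-splitAt-inject₁ u (toV C) C x≢u ×-⇔ ∈-splitAt-inject₁ u (toV C) C y≢u

  SharedBy-split-v⊎w : {x : Fin n} → ¬ x ≡ u →
                       (SharedBy 𝒞′ (inject₁ x) v ⊎ SharedBy 𝒞′ (inject₁ x) w) ⇔ SharedBy 𝒞 x u
  SharedBy-split-v⊎w x≢u = ⇔.trans (↔⇒⇔ Any.⊎↔)
    (Any-map⇔ λ {C} → ⇔.trans (⇔.sym (↔⇒⇔ ×-distribˡ-⊎))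
                               (∈-splitAt-inject₁ u (toV C) C x≢u ×-⇔ ∈-splitAt-v⊎w u (toV C) C))

  ¬SharedBy-split-v-w : ¬ SharedBy 𝒞′ v w
  ¬SharedBy-split-v-w shared with find (Any.map⁻ shared)
  ... | C , _ , v∈ , w∈
    with () ← trans (sym (proj₁ (to (∈-splitAt-v u (toV C) C) v∈)))
                    (proj₁ (to (∈-splitAt-w u (toV C) C) w∈))

  IsSplit-split : (G : Graph n) → (∀ x y → adj G x y ≡ adj (coverGraph 𝒞) x y) →
                  IsSplit G u (coverGraph 𝒞′)
  IsSplit-split G G≗𝒞 = old , copies , dec-false (joined? 𝒞′ v w) (¬SharedBy-split-v-w ∘ proj₂)
    where
    old : ∀ x y → ¬ x ≡ u → ¬ y ≡ u → adj (coverGraph 𝒞′) (inject₁ x) (inject₁ y) ≡ adj G x y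
    old x y x≢u y≢u = trans
      (does-⇔ (inject₁-≢⇔ ×-⇔ SharedBy-split-inject₁ x≢u y≢u) (joined? 𝒞′ _ _) (joined? 𝒞 x y))
      (sym (G≗𝒞 x y))
    copies : ∀ x → ¬ x ≡ u →
             adj G x u ≡ (adj (coverGraph 𝒞′) (inject₁ x) v ∨ adj (coverGraph 𝒞′) (inject₁ x) w)
    copies x x≢u = trans (G≗𝒞 x u) (does-⇔ (⇔.trans (Joined⇔SharedBy x≢u) (⇔.sym (⇔.trans
      (Joined⇔SharedBy (x≢u ∘ inject₁-injective) ⊎-⇔ Joined⇔SharedBy (fromℕ≢inject₁ ∘ sym))
      (SharedBy-split-v⊎w x≢u))))
      (joined? 𝒞 x u) (joined? 𝒞′ _ v ⊎-dec joined? 𝒞′ _ w))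

  Joined-split-inject₁ : {x : Fin n} → ¬ x ≡ u → ∃ (Joined 𝒞 x) → ∃ (Joined 𝒞′ (inject₁ x))
  Joined-split-inject₁ {x} x≢u (y , x≢y , shared) with y ≟ u
  ... | no y≢u = inject₁ y , x≢y ∘ inject₁-injective , from (SharedBy-split-inject₁ x≢u y≢u) shared
  ... | yes refl with from (SharedBy-split-v⊎w x≢u) shared
  ...   | inj₁ shared-v = v , x≢u ∘ inject₁-injective , shared-v
  ...   | inj₂ shared-w = w , fromℕ≢inject₁ ∘ sym , shared-w

  Joined-split-v : C₁ ∈ₗ 𝒞 → u ∈ C₁ → 1 < ∣ C₁ ∣ → ∃ (Joined 𝒞′ v)
  Joined-split-v C₁∈𝒞 u∈C₁ 1<∣C₁∣ with other-element C₁ u 1<∣C₁∣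
  ... | y , y≢u , y∈C₁ = inject₁ y , y≢u ∘ sym ∘ inject₁-injective ,
    Any.map⁺ (lose C₁∈𝒞 (from (∈-splitAt-v u (toV C₁) C₁) (dec-true (C₁ ≟ₛ C₁) refl , u∈C₁) ,
                         from (∈-splitAt-inject₁ u (toV C₁) C₁ y≢u) y∈C₁))

  Joined-split-w : {C : Subset n} → C ∈ₗ 𝒞 → ¬ C ≡ C₁ → u ∈ C → 1 < ∣ C ∣ → ∃ (Joined 𝒞′ w)
  Joined-split-w {C} C∈𝒞 C≢C₁ u∈C 1<∣C∣ with other-element C u 1<∣C∣
  ... | y , y≢u , y∈C = inject₁ y , fromℕ≢inject₁ ,
    Any.map⁺ (lose C∈𝒞 (from (∈-splitAt-w u (toV C) C) (dec-false (C ≟ₛ C₁) C≢C₁ , u∈C) ,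
                        from (∈-splitAt-inject₁ u (toV C) C y≢u) y∈C))

  NoIsolated-split : (∀ x → ∃ (Joined 𝒞 x)) → ∃ (Joined 𝒞′ v) → ∃ (Joined 𝒞′ w) →
                     NoIsolated (coverGraph 𝒞′)
  NoIsolated-split joined v-joined w-joined i = map₂ (from Adj-coverGraph) (neighbour i (view i))
    where
    neighbour : ∀ i → View i → ∃ (Joined 𝒞′ i)
    neighbour _ ‵fromℕ = w-joined
    neighbour _ (‵inject₁ x) with x ≟ u
    ... | yes refl = v-joined
    ... | no x≢u   = Joined-split-inject₁ x≢u (joined x)

lemma3 : ∀ {n} (G : Graph n) (α : ℕ) (𝒞 : List (Subset n)) →
         NoIsolated G → IsSigmaCliqueCover G 𝒞 → wgt 𝒞 ≤ n + α → AllLarge 𝒞 →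
         IsClusterGraph G ⊎
         Σ (Fin n) (λ u → Σ (Graph (suc n)) (λ G' → IsSplit G u G' ×
           Σ (List (Subset (suc n))) (λ 𝒞' → IsSigmaCliqueCover G' 𝒞' ×
             (wgt 𝒞' + 1 ≤ suc n + α) × AllLarge 𝒞') × NoIsolated G'))
lemma3 {n} G α 𝒞 noIsolated cover@(unique , _ , _) wgt≤ allLarge with any? (overlapAt? 𝒞)
... | no ∄overlap =
  inj₁ (nonoverlapping⇒isClusterGraph G cover (¬OverlapAt⇒Nonoverlapping ∄overlap))
... | yes (u , overlapping) with find overlapping
... | C₁ , C₁∈𝒞 , overlapping₂ with find overlapping₂
... | C₂ , C₂∈𝒞 , C₁≢C₂ , u∈C₁ , u∈C₂ =
  inj₂ (u , coverGraph 𝒞′ , IsSplit-split G (adj≡adj-coverGraph G cover) ,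
        (𝒞′ , coverGraph-isSigmaCliqueCover (Unique-split unique) , wgt-bound ,
              AllLarge-split allLarge) ,
        NoIsolated-split joined
          (Joined-split-v C₁∈𝒞 u∈C₁ (All.lookup allLarge C₁∈𝒞))
          (Joined-split-w C₂∈𝒞 (C₁≢C₂ ∘ sym) u∈C₂ (All.lookup allLarge C₂∈𝒞)))
  where
  open SplitCover 𝒞 u C₁

  joined : ∀ x → ∃ (Joined 𝒞 x)
  joined x = map₂ (to (Adj⇔Joined G cover)) (noIsolated x)

  wgt-bound : wgt 𝒞′ + 1 ≤ suc n + α
  wgt-bound = begin
    wgt 𝒞′ + 1 ≡⟨ cong (_+ 1) wgt-split ⟩
    wgt 𝒞 + 1  ≤⟨ ℕ.+-monoˡ-≤ 1 wgt≤ ⟩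
    n + α + 1  ≡⟨ ℕ.+-comm (n + α) 1 ⟩
    suc n + α  ∎
    where open ℕ.≤-Reasoning
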